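{- Let $G$ be a finite simple graph, $A_1,A_2$ disjoint subsets of $V(G)$, and $G^*$ the graph obtained by toggling all pairs between $A_1$ and $A_2$, with closed neighborhood matrices $N$ and $N^*$. Suppose $A_1$, $A_2$ and $A_1\cup A_2$ are all HO sets in $G$. Then for every pattern $\mathbf{p}$, $N^*\mathbf{p}=\mathbf{1}$ if and only if $N\mathbf{p}=\mathbf{1}$ and $\mathbf{x}_{A_1}\cdot\mathbf{p}=\mathbf{x}_{A_2}\cdot\mathbf{p}=0$. Moreover, $A_1$ and $A_2$ are NO in $G^*$ and $\nu(G^*)=\nu(G)-2$.
   Context: For a graph $H$ with vertex set $V=\{v_1,\dots,v_n\}$, $N(H)$ is the closed neighborhood matrix over $\mathbb{Z}_2$ (entry $(i,j)$ is $1$ iff $i=j$ or $v_iv_j$ is an edge), $\nu(H)=\dim\ker N(H)$. Given disjoint $A_1,A_2\subseteq V(G)$, $G^*$ is obtained from $G$ by, for every $u\in A_1$, $v\in A_2$, adding the edge $uv$ if $u,v$ are non-adjacent and removing it if they are adjacent; $N=N(G)$, $N^*=N(G^*)$. Subsets $A$ are identified with characteristic vectors $\mathbf{x}_A$; $\mathbf{x}\cdot\mathbf{y}=\mathbf{x}^t\mathbf{y}$ over $\mathbb{Z}_2$; $\mathbf{1}$ is the all-ones vector. In a graph $H$ with matrix $M$: a set $A$ is solvable if $M\mathbf{p}=\mathbf{x}_A$ has a solution; $A$ is HO if it is not solvable. For solvable $A$, $A$ is AO if $\mathbf{x}_A\cdot\mathbf{p}=1$ for all $\mathbf{p}$ with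 $M\mathbf{p}=\mathbf{1}$, and NO if $\mathbf{x}_A\cdot\mathbf{p}=0$ for all such $\mathbf{p}$ (such $\mathbf{p}$ always exist). -}

module Defs where

open import Data.Nat using (ℕ; zero; suc)
open import Data.Bool using (Bool; true; false; _∧_; _∨_; _xor_)
open import Data.Fin using (Fin; zero; suc; _≟_)
open import Data.Product using (Σ; _×_)
open import Relation.Nullary using (¬_)
open import Relation.Nullary.Decidable using (⌊_⌋)
open import Relation.Binary.PropositionalEquality using (_≡_)

-- Vectors over ℤ₂ (true = 1, false = 0); addition is xor, product is ∧.
Vec₂ : ℕ → Set
Vec₂ n = Fin n → Bool

Mat₂ : ℕ → Set
Mat₂ n = Fin n → Fin n → Bool

sum₂ : ∀ {n} → (Fin n → Bool) → Bool
sum₂ {zero}  f = false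
sum₂ {suc n} f = f zero xor sum₂ (λ i → f (suc i))

_·_ : ∀ {n} → Vec₂ n → Vec₂ n → Bool
x · y = sum₂ (λ i → x i ∧ y i)

_⊛_ : ∀ {n} → Mat₂ n → Vec₂ n → Vec₂ n
(M ⊛ p) i = sum₂ (λ j → M i j ∧ p j)

_≐_ : ∀ {n} → Vec₂ n → Vec₂ n → Set
x ≐ y = ∀ i → x i ≡ y i

𝟏 : ∀ {n} → Vec₂ n
𝟏 _ = true

𝟎 : ∀ {n} → Vec₂ n
𝟎 _ = false

record Graph (n : ℕ) : Set where
  field
    adj   : Fin n → Fin n → Bool
    sym   : ∀ i j → adj i j ≡ adj j i
    irref : ∀ i → adj i i ≡ false
open Graph public

N : ∀ {n} → Graph n → Mat₂ n
N H i j = ⌊ i ≟ j ⌋ ∨ adj H i j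

-- Subsets of V are identified with their characteristic vectors.
Disjoint : ∀ {n} → Vec₂ n → Vec₂ n → Set
Disjoint A₁ A₂ = ∀ i → A₁ i ∧ A₂ i ≡ false

_∪_ : ∀ {n} → Vec₂ n → Vec₂ n → Vec₂ n
(A ∪ B) i = A i ∨ B i

toggle-adj : ∀ {n} → Graph n → Vec₂ n → Vec₂ n → Fin n → Fin n → Bool
toggle-adj G A₁ A₂ u v = adj G u v xor ((A₁ u ∧ A₂ v) ∨ (A₂ u ∧ A₁ v))

Solvable : ∀ {n} → Mat₂ n → Vec₂ n → Set
Solvable M A = Σ (Vec₂ _) (λ p → (M ⊛ p) ≐ A)

HO : ∀ {n} → Mat₂ n → Vec₂ n → Set
HO M A = ¬ Solvable M A

NO : ∀ {n} → Mat₂ n → Vec₂ n → Set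
NO M A = Solvable M A × (∀ p → (M ⊛ p) ≐ 𝟏 → A · p ≡ false)

lincomb : ∀ {n k} → (Fin k → Vec₂ n) → (Fin k → Bool) → Vec₂ n
lincomb b c j = sum₂ (λ i → c i ∧ b i j)

-- "dim ker M = d": there is a basis of ker M consisting of d vectors.
record KerBasis {n : ℕ} (M : Mat₂ n) (d : ℕ) : Set where
  field
    vec      : Fin d → Vec₂ n
    inKer    : ∀ i → (M ⊛ vec i) ≐ 𝟎
    indep    : ∀ c → lincomb vec c ≐ 𝟎 → c ≐ 𝟎
    spanning : ∀ p → (M ⊛ p) ≐ 𝟎 → Σ (Fin d → Bool) (λ c → lincomb vec c ≐ p)

DimKer : ∀ {n} → Mat₂ n → ℕ → Set
DimKer M d = KerBasis M d

-- Toggling the pairs between A₁ and A₂ adds the rank-two matrix A₁A₂ᵗ + A₂A₁ᵗ to N, so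
-- N*p = Np + (A₂·p)A₁ + (A₁·p)A₂. Since N is symmetric, a set is HO exactly when some
-- kernel vector of N meets it oddly; the three HO hypotheses therefore give u₁, u₂ ∈ ker N
-- with A_i·u_j = δ_ij. Dotting N*p = w with u₁ and u₂, for any w orthogonal to ker N
-- (such as 𝟏 or 𝟎), forces A₁·p = A₂·p = 0, after which N*p = Np. With w = 𝟏 this is the
-- equivalence of solutions, N*u₂ = A₁ and N*u₁ = A₂ show that A₁, A₂ are NO in G*, and
-- with w = 𝟎 it shows ker N = ker N* ⊕ span(u₁, u₂).
module Submission where

open import Defs hiding (sym)
open import Data.Nat using (ℕ; _+_)
open import Data.Bool using (false)
open import Data.Product using (_×_)
open import Function.Bundles using (_⇔_)
open import Relation.Binary.PropositionalEquality using (_≡_)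

open import Algebra.Bundles using (CommutativeMonoid; CommutativeRing)
import Algebra.Properties.CommutativeSemigroup as CommutativeSemigroupProperties
open import Data.Bool using (Bool; true; _∧_; _∨_; _xor_)
open import Data.Bool.Properties
  using ( ∧-comm; ∧-assoc; ∧-idem; ∧-identityʳ; ∧-zeroʳ; ∧-distribˡ-xor; ∧-distribʳ-xor
        ; xor-comm; xor-assoc; xor-same; xor-identityʳ; ¬-not; not-injective
        ; ∧-commutativeMonoid; xor-∧-commutativeRing)
  renaming (_≟_ to _≟ᵇ_)
open import Data.Empty using (⊥-elim)
open import Data.Fin using (Fin; zero; suc; _≟_; combine; funToFin; finToFun)
open import Data.Fin.Properties
  using (any?; injective⇒≤; funToFin-finToFin; finToFun-funToFin; 2↔Bool)
open import Data.Nat using (zero; suc; _≤_; _^_; s≤s; z≤n)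
open import Data.Nat.Properties using (≮⇒≥; <⇒≱; ^-monoʳ-<; ≤-antisym; +-comm)
open import Data.Product using (Σ; _,_; proj₁; proj₂)
open import Data.Sum using (_⊎_; inj₁; inj₂)
open import Data.Vec.Functional using (_∷_)
open import Function.Base using (_∘_)
open import Function.Bundles using (mk⇔; Inverse; Equivalence)
open import Relation.Nullary using (yes; no)
open import Relation.Nullary.Decidable using (⌊_⌋; isYes≗does; dec-true; dec-false)
open import Relation.Binary.PropositionalEquality
  using (refl; sym; trans; cong; cong₂; module ≡-Reasoning)

open ≡-Reasoning

private
  module ∧ = CommutativeSemigroupProperties
    (CommutativeMonoid.commutativeSemigroup ∧-commutativeMonoid)
  module xor = CommutativeSemigroupProperties
    (CommutativeRing.+-commutativeSemigroup xor-∧-commutativeRing)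

xor-cancelˡ : ∀ x y → x xor (x xor y) ≡ y
xor-cancelˡ x y = trans (sym (xor-assoc x x y)) (cong (_xor y) (xor-same x))

∨≡xor : ∀ {x y} → x ∧ y ≡ false → x ∨ y ≡ x xor y
∨≡xor {true}  {true}  ()
∨≡xor {true}  {false} _ = refl
∨≡xor {false}         _ = refl

sum₂-cong : ∀ {n} {f g : Fin n → Bool} → (∀ i → f i ≡ g i) → sum₂ f ≡ sum₂ g
sum₂-cong {zero}  _   = refl
sum₂-cong {suc n} f≗g = cong₂ _xor_ (f≗g zero) (sum₂-cong (f≗g ∘ suc))

sum₂-zero : ∀ {n} {f : Fin n → Bool} → (∀ i → f i ≡ false) → sum₂ f ≡ false
sum₂-zero {zero}  _   = refl
sum₂-zero {suc n} f≗0 = cong₂ _xor_ (f≗0 zero) (sum₂-zero (f≗0 ∘ suc))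

sum₂-xor : ∀ {n} (f g : Fin n → Bool) → sum₂ (λ i → f i xor g i) ≡ sum₂ f xor sum₂ g
sum₂-xor {zero}  f g = refl
sum₂-xor {suc n} f g = trans (cong ((f zero xor g zero) xor_) (sum₂-xor (f ∘ suc) (g ∘ suc)))
                             (xor.interchange (f zero) (g zero) _ _)

sum₂-∧ˡ : ∀ {n} b (f : Fin n → Bool) → sum₂ (λ i → b ∧ f i) ≡ b ∧ sum₂ f
sum₂-∧ˡ {zero}  b f = sym (∧-zeroʳ b)
sum₂-∧ˡ {suc n} b f = trans (cong (b ∧ f zero xor_) (sum₂-∧ˡ b (f ∘ suc)))
                            (sym (∧-distribˡ-xor b (f zero) _))

sum₂-swap : ∀ {m n} (f : Fin m → Fin n → Bool) →
            sum₂ (λ i → sum₂ (f i)) ≡ sum₂ (λ j → sum₂ (λ i → f i j))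
sum₂-swap {zero} {n} f = sym (sum₂-zero {n} {λ _ → false} (λ _ → refl))
sum₂-swap {suc m} f = trans (cong (sum₂ (f zero) xor_) (sum₂-swap (f ∘ suc)))
                            (sym (sum₂-xor (f zero) _))

sum₂-symmetric : ∀ {n} (f : Fin n → Fin n → Bool) → (∀ i j → f i j ≡ f j i) →
                 sum₂ (λ i → sum₂ (f i)) ≡ sum₂ (λ i → f i i)
sum₂-symmetric {zero}  f f-sym = refl
sum₂-symmetric {suc n} f f-sym = begin
  (f zero zero xor row) xor sum₂ (λ i → f (suc i) zero xor sum₂ (f (suc i) ∘ suc))
    ≡⟨ cong ((f zero zero xor row) xor_)
            (sum₂-xor (λ i → f (suc i) zero) (λ i → sum₂ (f (suc i) ∘ suc))) ⟩
  (f zero zero xor row) xor (sum₂ (λ i → f (suc i) zero) xor inner)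
    ≡⟨ cong (λ col → (f zero zero xor row) xor (col xor inner))
            (sum₂-cong (λ i → f-sym (suc i) zero)) ⟩
  (f zero zero xor row) xor (row xor inner)
    ≡⟨ xor-assoc (f zero zero) row (row xor inner) ⟩
  f zero zero xor (row xor (row xor inner))
    ≡⟨ cong (f zero zero xor_) (xor-cancelˡ row inner) ⟩
  f zero zero xor inner
    ≡⟨ cong (f zero zero xor_) (sum₂-symmetric (λ i j → f (suc i) (suc j))
                                              (λ i j → f-sym (suc i) (suc j))) ⟩
  f zero zero xor sum₂ (λ i → f (suc i) (suc i)) ∎
  where
  row   = sum₂ (f zero ∘ suc)
  inner = sum₂ (λ i → sum₂ (f (suc i) ∘ suc))

infixr 5 _⊕_
infixr 6 _⋆_

_⊕_ : ∀ {n} → Vec₂ n → Vec₂ n → Vec₂ n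
(x ⊕ y) i = x i xor y i

_⋆_ : ∀ {n} → Bool → Vec₂ n → Vec₂ n
(b ⋆ x) i = b ∧ x i

unit : ∀ {n} → Fin n → Vec₂ n
unit zero    = true ∷ 𝟎
unit (suc r) = false ∷ unit r

·-comm : ∀ {n} (x y : Vec₂ n) → x · y ≡ y · x
·-comm x y = sum₂-cong (λ i → ∧-comm (x i) (y i))

·-congˡ : ∀ {n} {x y : Vec₂ n} → x ≐ y → ∀ z → x · z ≡ y · z
·-congˡ x≐y z = sum₂-cong (λ i → cong (_∧ z i) (x≐y i))

·-congʳ : ∀ {n} (x : Vec₂ n) {y z} → y ≐ z → x · y ≡ x · z
·-congʳ x y≐z = sum₂-cong (λ i → cong (x i ∧_) (y≐z i))

·-zeroʳ : ∀ {n} (x : Vec₂ n) → x · 𝟎 ≡ false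
·-zeroʳ x = sum₂-zero (λ i → ∧-zeroʳ (x i))

·-⊕ʳ : ∀ {n} (x y z : Vec₂ n) → x · (y ⊕ z) ≡ x · y xor x · z
·-⊕ʳ x y z = trans (sum₂-cong (λ i → ∧-distribˡ-xor (x i) (y i) (z i)))
                   (sum₂-xor (λ i → x i ∧ y i) (λ i → x i ∧ z i))

·-⊕ˡ : ∀ {n} (x y z : Vec₂ n) → (x ⊕ y) · z ≡ x · z xor y · z
·-⊕ˡ x y z = trans (sum₂-cong (λ i → ∧-distribʳ-xor (z i) (x i) (y i)))
                   (sum₂-xor (λ i → x i ∧ z i) (λ i → y i ∧ z i))

·-⋆ˡ : ∀ {n} b (x y : Vec₂ n) → (b ⋆ x) · y ≡ b ∧ x · y
·-⋆ˡ b x y = trans (sum₂-cong (λ i → ∧-assoc b (x i) (y i))) (sum₂-∧ˡ b (λ i → x i ∧ y i))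

·-unitʳ : ∀ {n} (x : Vec₂ n) r → x · unit r ≡ x r
·-unitʳ x zero    = trans (cong (x zero ∧ true xor_) (·-zeroʳ (x ∘ suc)))
                          (trans (xor-identityʳ _) (∧-identityʳ (x zero)))
·-unitʳ x (suc r) = cong₂ _xor_ (∧-zeroʳ (x zero)) (·-unitʳ (x ∘ suc) r)

·-lincomb : ∀ {n d} (x : Vec₂ n) (b : Fin d → Vec₂ n) c → x · lincomb b c ≡ c · (λ l → x · b l)
·-lincomb x b c = begin
  sum₂ (λ i → x i ∧ sum₂ (λ l → c l ∧ b l i))
    ≡⟨ sum₂-cong (λ i → sym (sum₂-∧ˡ (x i) (λ l → c l ∧ b l i))) ⟩
  sum₂ (λ i → sum₂ (λ l → x i ∧ c l ∧ b l i))
    ≡⟨ sum₂-swap (λ i l → x i ∧ c l ∧ b l i) ⟩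
  sum₂ (λ l → sum₂ (λ i → x i ∧ c l ∧ b l i))
    ≡⟨ sum₂-cong (λ l → trans (sum₂-cong (λ i → ∧.x∙yz≈y∙xz (x i) (c l) (b l i)))
                              (sum₂-∧ˡ (c l) (λ i → x i ∧ b l i))) ⟩
  sum₂ (λ l → c l ∧ x · b l) ∎

·-⊛ : ∀ {n} (x : Vec₂ n) M y → x · (M ⊛ y) ≡ sum₂ (λ i → sum₂ (λ j → x i ∧ M i j ∧ y j))
·-⊛ x M y = sum₂-cong (λ i → sym (sum₂-∧ˡ (x i) (λ j → M i j ∧ y j)))

Ker : ∀ {n} → Mat₂ n → Vec₂ n → Set
Ker M k = (M ⊛ k) ≐ 𝟎

Ker-⊕ : ∀ {n} {M : Mat₂ n} {x y} → Ker M x → Ker M y → Ker M (x ⊕ y)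
Ker-⊕ {M = M} {x} {y} x∈ker y∈ker i =
  trans (·-⊕ʳ (M i) x y) (cong₂ _xor_ (x∈ker i) (y∈ker i))

Ker-lincomb : ∀ {n d} {M : Mat₂ n} {b : Fin d → Vec₂ n} →
              (∀ l → Ker M (b l)) → ∀ c → Ker M (lincomb b c)
Ker-lincomb {M = M} {b} b∈ker c i =
  trans (·-lincomb (M i) b c) (trans (·-congʳ c (λ l → b∈ker l i)) (·-zeroʳ c))

-- In the step, a
-- separator k of a from the tail that fails on c₀ is repaired by a separator k' of
-- c₀ ⊕ a from the tail: either k' already separates a, or k ⊕ k' does.
span-or-separator : ∀ {n m} (c : Fin m → Vec₂ n) (a : Vec₂ n) →
  (Σ (Fin m → Bool) λ x → lincomb c x ≐ a) ⊎
  (Σ (Vec₂ n) λ k → (∀ j → k · c j ≡ false) × (k · a ≡ true))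
span-or-separator {m = zero} c a with any? (λ i → a i ≟ᵇ true)
... | yes (i , aᵢ) = inj₂ (unit i , (λ ()) , trans (·-comm (unit i) a) (trans (·-unitʳ a i) aᵢ))
... | no ∄i = inj₁ (𝟎 , λ i → sym (¬-not (λ aᵢ → ∄i (i , aᵢ))))
span-or-separator {m = suc m} c a with span-or-separator (c ∘ suc) a
... | inj₁ (x , cx≐a) = inj₁ (false ∷ x , cx≐a)
... | inj₂ (k , k⊥c , k·a) with k · c zero in k·c₀
...   | false = inj₂ (k , (λ { zero → k·c₀ ; (suc j) → k⊥c j }) , k·a)
...   | true with span-or-separator (c ∘ suc) (c zero ⊕ a)
...     | inj₁ (x , cx≐c₀⊕a) =
          inj₁ (true ∷ x , λ i → trans (cong (c zero i xor_) (cx≐c₀⊕a i))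
                                       (xor-cancelˡ (c zero i) (a i)))
...     | inj₂ (k' , k'⊥c , k'·c₀⊕a) with k' · c zero in k'·c₀
...       | false = inj₂ (k' , (λ { zero → k'·c₀ ; (suc j) → k'⊥c j }) , k'·a)
  where
  k'·a : k' · a ≡ true
  k'·a = trans (sym (cong (_xor k' · a) k'·c₀)) (trans (sym (·-⊕ʳ k' (c zero) a)) k'·c₀⊕a)
...       | true = inj₂ (k ⊕ k' , k⊕k'⊥c , trans (·-⊕ˡ k k' a) (cong₂ _xor_ k·a k'·a))
  where
  k'·a : k' · a ≡ false
  k'·a = not-injective (begin
    true xor k' · a          ≡⟨ cong (_xor k' · a) (sym k'·c₀) ⟩
    k' · c zero xor k' · a   ≡⟨ sym (·-⊕ʳ k' (c zero) a) ⟩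
    k' · (c zero ⊕ a)        ≡⟨ k'·c₀⊕a ⟩
    true                     ∎)
  k⊕k'⊥c : ∀ j → (k ⊕ k') · c j ≡ false
  k⊕k'⊥c zero    = trans (·-⊕ˡ k k' (c zero)) (cong₂ _xor_ k·c₀ k'·c₀)
  k⊕k'⊥c (suc j) = trans (·-⊕ˡ k k' (c (suc j))) (cong₂ _xor_ (k⊥c j) (k'⊥c j))

SymmetricMat : ∀ {n} → Mat₂ n → Set
SymmetricMat M = ∀ i j → M i j ≡ M j i

⊛-selfAdjoint : ∀ {n} {M : Mat₂ n} → SymmetricMat M → ∀ x y → (M ⊛ x) · y ≡ x · (M ⊛ y)
⊛-selfAdjoint {M = M} M-sym x y = begin
  (M ⊛ x) · y                                    ≡⟨ ·-comm (M ⊛ x) y ⟩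
  y · (M ⊛ x)                                    ≡⟨ ·-⊛ y M x ⟩
  sum₂ (λ i → sum₂ (λ j → y i ∧ M i j ∧ x j))   ≡⟨ sum₂-swap (λ i j → y i ∧ M i j ∧ x j) ⟩
  sum₂ (λ j → sum₂ (λ i → y i ∧ M i j ∧ x j))   ≡⟨ sum₂-cong (λ j → sum₂-cong (reverse j)) ⟩
  sum₂ (λ j → sum₂ (λ i → x j ∧ M j i ∧ y i))   ≡⟨ sym (·-⊛ x M y) ⟩
  x · (M ⊛ y)                                    ∎
  where
  reverse : ∀ j i → y i ∧ M i j ∧ x j ≡ x j ∧ M j i ∧ y i
  reverse j i = trans (∧.x∙yz≈z∙yx (y i) (M i j) (x j)) (cong (λ m → x j ∧ m ∧ y i) (M-sym i j))

range⊥ker : ∀ {n} {M : Mat₂ n} {k} → SymmetricMat M → Ker M k → ∀ p → (M ⊛ p) · k ≡ false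
range⊥ker {M = M} {k} M-sym k∈ker p =
  trans (⊛-selfAdjoint M-sym p k) (trans (·-congʳ p k∈ker) (·-zeroʳ p))

𝟏⊥ker : ∀ {n} {M : Mat₂ n} {k} → SymmetricMat M → (∀ i → M i i ≡ true) → Ker M k → 𝟏 · k ≡ false
𝟏⊥ker {M = M} {k} M-sym M-diag k∈ker = begin
  𝟏 · k                                          ≡⟨ sum₂-cong (λ i → sym (diagonal i)) ⟩
  sum₂ (λ i → k i ∧ M i i ∧ k i)                 ≡⟨ sym (sum₂-symmetric _ reverse) ⟩
  sum₂ (λ i → sum₂ (λ j → k i ∧ M i j ∧ k j))   ≡⟨ sym (·-⊛ k M k) ⟩
  k · (M ⊛ k)                                    ≡⟨ ·-congʳ k k∈ker ⟩
  k · 𝟎                                          ≡⟨ ·-zeroʳ k ⟩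
  false                                          ∎
  where
  diagonal : ∀ i → k i ∧ M i i ∧ k i ≡ k i
  diagonal i = trans (cong (λ m → k i ∧ m ∧ k i) (M-diag i)) (∧-idem (k i))
  reverse : ∀ i j → k i ∧ M i j ∧ k j ≡ k j ∧ M j i ∧ k i
  reverse i j = trans (∧.x∙yz≈z∙yx (k i) (M i j) (k j)) (cong (λ m → k j ∧ m ∧ k i) (M-sym i j))

HO⇒ker-witness : ∀ {n} {M : Mat₂ n} {a} → SymmetricMat M → HO M a →
                 Σ (Vec₂ n) λ k → Ker M k × (a · k ≡ true)
HO⇒ker-witness {M = M} {a} M-sym a-HO with span-or-separator M a
... | inj₁ (x , Mx≐a) = ⊥-elim (a-HO (x , λ i → trans (rows i) (Mx≐a i)))
  where
  rows : ∀ i → (M ⊛ x) i ≡ lincomb M x i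
  rows i = sum₂-cong (λ j → trans (∧-comm (M i j) (x j)) (cong (x j ∧_) (M-sym i j)))
... | inj₂ (k , k⊥M , k·a) =
  k , (λ i → trans (·-comm (M i) k) (k⊥M i)) , trans (·-comm a k) k·a

encode : ∀ {d} → (Fin d → Bool) → Fin (2 ^ d)
encode c = funToFin (Inverse.from 2↔Bool ∘ c)

decode : ∀ {d} → Fin (2 ^ d) → Fin d → Bool
decode {d} i = Inverse.to 2↔Bool ∘ finToFun {2} {d} i

funToFin-cong : ∀ {m n} {f g : Fin m → Fin n} → (∀ i → f i ≡ g i) → funToFin f ≡ funToFin g
funToFin-cong {zero}  _   = refl
funToFin-cong {suc m} f≗g = cong₂ combine (f≗g zero) (funToFin-cong (f≗g ∘ suc))

decode-encode : ∀ {d} (c : Fin d → Bool) → decode (encode c) ≐ c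
decode-encode c l = trans (cong (Inverse.to 2↔Bool) (finToFun-funToFin _ l))
                          (Inverse.strictlyInverseˡ 2↔Bool (c l))

encode-decode : ∀ {d} (i : Fin (2 ^ d)) → encode (decode {d} i) ≡ i
encode-decode {d} i =
  trans (funToFin-cong (λ l → Inverse.strictlyInverseʳ 2↔Bool (finToFun {2} {d} i l)))
        (funToFin-finToFin {d} i)

≐-injective⇒≤ : ∀ {d e} (g : (Fin d → Bool) → (Fin e → Bool)) →
                (∀ c c' → g c ≐ g c' → c ≐ c') → d ≤ e
≐-injective⇒≤ {d} {e} g g-injective =
  ≮⇒≥ (λ e<d → <⇒≱ (^-monoʳ-< 2 (s≤s (s≤s z≤n)) e<d) (injective⇒≤ h-injective))
  where
  h : Fin (2 ^ d) → Fin (2 ^ e)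
  h = encode ∘ g ∘ decode
  h-injective : ∀ {i j} → h i ≡ h j → i ≡ j
  h-injective {i} {j} hi≡hj = begin
    i                       ≡⟨ sym (encode-decode {d} i) ⟩
    encode (decode {d} i)   ≡⟨ funToFin-cong (cong (Inverse.from 2↔Bool) ∘ g-injective _ _ same) ⟩
    encode (decode {d} j)   ≡⟨ encode-decode {d} j ⟩
    j                       ∎
    where
    same : g (decode {d} i) ≐ g (decode j)
    same l = trans (sym (decode-encode _ l)) (trans (cong (λ x → decode x l) hi≡hj) (decode-encode _ l))

Independent : ∀ {n d} → (Fin d → Vec₂ n) → Set
Independent b = ∀ c → lincomb b c ≐ 𝟎 → c ≐ 𝟎

independent≤spanning : ∀ {n d e} (b : Fin d → Vec₂ n) (f : Fin e → Vec₂ n) → Independent b →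
  (∀ c → Σ (Fin e → Bool) λ c' → lincomb f c' ≐ lincomb b c) → d ≤ e
independent≤spanning b f b-independent f-spans =
  ≐-injective⇒≤ (proj₁ ∘ f-spans) coordinates-injective
  where
  coordinates-injective : ∀ c c' → proj₁ (f-spans c) ≐ proj₁ (f-spans c') → c ≐ c'
  coordinates-injective c c' same l = begin
    c l                      ≡⟨ sym (xor-identityʳ (c l)) ⟩
    c l xor false            ≡⟨ cong (c l xor_) (sym (b-independent (c ⊕ c') difference l)) ⟩
    c l xor (c l xor c' l)   ≡⟨ xor-cancelˡ (c l) (c' l) ⟩
    c' l                     ∎
    where
    difference : lincomb b (c ⊕ c') ≐ 𝟎
    difference j = begin
      lincomb b (c ⊕ c') j                ≡⟨ ·-⊕ˡ c c' _ ⟩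
      lincomb b c j xor lincomb b c' j    ≡⟨ cong (_xor lincomb b c' j) (begin
        lincomb b c j                       ≡⟨ sym (proj₂ (f-spans c) j) ⟩
        lincomb f (proj₁ (f-spans c)) j     ≡⟨ ·-congˡ same _ ⟩
        lincomb f (proj₁ (f-spans c')) j    ≡⟨ proj₂ (f-spans c') j ⟩
        lincomb b c' j                      ∎) ⟩
      lincomb b c' j xor lincomb b c' j   ≡⟨ xor-same (lincomb b c' j) ⟩
      false                               ∎

record DualPair {n} (M : Mat₂ n) (A₁ A₂ : Vec₂ n) : Set where
  field
    u₁ u₂       : Vec₂ n
    u₁∈ker      : Ker M u₁
    u₂∈ker      : Ker M u₂
    A₁·u₁≡true  : A₁ · u₁ ≡ true
    A₂·u₁≡false : A₂ · u₁ ≡ false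
    A₁·u₂≡false : A₁ · u₂ ≡ false
    A₂·u₂≡true  : A₂ · u₂ ≡ true

ker-separating-vector : ∀ {n} {M : Mat₂ n} (B₁ B₂ : Vec₂ n) {k₁ k₂ k₃} →
  Ker M k₁ → Ker M k₂ → Ker M k₃ →
  B₁ · k₁ ≡ true → B₂ · k₂ ≡ true → B₁ · k₃ xor B₂ · k₃ ≡ true →
  Σ (Vec₂ n) λ u → Ker M u × (B₁ · u ≡ false) × (B₂ · u ≡ true)
ker-separating-vector {M = M} B₁ B₂ {k₁} {k₂} {k₃} k₁∈ker k₂∈ker k₃∈ker B₁·k₁ B₂·k₂ B₁·k₃⊕B₂·k₃
  with B₁ · k₂ in B₁·k₂
... | false = k₂ , k₂∈ker , B₁·k₂ , B₂·k₂
... | true with B₂ · k₁ in B₂·k₁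
...   | false = k₁ ⊕ k₂ , Ker-⊕ {M = M} k₁∈ker k₂∈ker ,
                trans (·-⊕ʳ B₁ k₁ k₂) (cong₂ _xor_ B₁·k₁ B₁·k₂) ,
                trans (·-⊕ʳ B₂ k₁ k₂) (cong₂ _xor_ B₂·k₁ B₂·k₂)
...   | true with B₁ · k₃ in B₁·k₃
...     | false = k₃ , k₃∈ker , B₁·k₃ , B₁·k₃⊕B₂·k₃
...     | true = k₁ ⊕ k₃ , Ker-⊕ {M = M} k₁∈ker k₃∈ker ,
                 trans (·-⊕ʳ B₁ k₁ k₃) (cong₂ _xor_ B₁·k₁ B₁·k₃) ,
                 trans (·-⊕ʳ B₂ k₁ k₃) (cong₂ _xor_ B₂·k₁ (not-injective B₁·k₃⊕B₂·k₃))

·-∪ : ∀ {n} {A₁ A₂ : Vec₂ n} → Disjoint A₁ A₂ → ∀ k → (A₁ ∪ A₂) · k ≡ A₁ · k xor A₂ · k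
·-∪ {A₁ = A₁} {A₂} disjoint k =
  trans (·-congˡ (λ i → ∨≡xor {A₁ i} {A₂ i} (disjoint i)) k) (·-⊕ˡ A₁ A₂ k)

dualPair : ∀ {n} {M : Mat₂ n} {A₁ A₂} → SymmetricMat M → Disjoint A₁ A₂ →
           HO M A₁ → HO M A₂ → HO M (A₁ ∪ A₂) → DualPair M A₁ A₂
dualPair {A₁ = A₁} {A₂} M-sym disjoint A₁-HO A₂-HO A₁∪A₂-HO =
  let k₁ , k₁∈ker , A₁·k₁ = HO⇒ker-witness M-sym A₁-HO
      k₂ , k₂∈ker , A₂·k₂ = HO⇒ker-witness M-sym A₂-HO
      k₃ , k₃∈ker , A₁∪A₂·k₃ = HO⇒ker-witness M-sym A₁∪A₂-HO
      A₁·k₃⊕A₂·k₃ = trans (sym (·-∪ disjoint k₃)) A₁∪A₂·k₃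
      u₂ , u₂∈ker , A₁·u₂ , A₂·u₂ =
        ker-separating-vector A₁ A₂ k₁∈ker k₂∈ker k₃∈ker A₁·k₁ A₂·k₂ A₁·k₃⊕A₂·k₃
      u₁ , u₁∈ker , A₂·u₁ , A₁·u₁ =
        ker-separating-vector A₂ A₁ k₂∈ker k₁∈ker k₃∈ker A₂·k₂ A₁·k₁
                              (trans (xor-comm (A₂ · k₃) (A₁ · k₃)) A₁·k₃⊕A₂·k₃)
  in record { u₁ = u₁ ; u₂ = u₂ ; u₁∈ker = u₁∈ker ; u₂∈ker = u₂∈ker
            ; A₁·u₁≡true = A₁·u₁ ; A₂·u₁≡false = A₂·u₁
            ; A₁·u₂≡false = A₁·u₂ ; A₂·u₂≡true = A₂·u₂ }

⌊≟⌋-refl : ∀ {n} (i : Fin n) → ⌊ i ≟ i ⌋ ≡ true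
⌊≟⌋-refl i = trans (isYes≗does (i ≟ i)) (dec-true (i ≟ i) refl)

⌊≟⌋-sym : ∀ {n} (i j : Fin n) → ⌊ i ≟ j ⌋ ≡ ⌊ j ≟ i ⌋
⌊≟⌋-sym i j with i ≟ j
... | yes refl = sym (⌊≟⌋-refl i)
... | no i≢j  = sym (trans (isYes≗does (j ≟ i)) (dec-false (j ≟ i) (λ j≡i → i≢j (sym j≡i))))

N-symmetric : ∀ {n} (H : Graph n) → SymmetricMat (N H)
N-symmetric H i j = cong₂ _∨_ (⌊≟⌋-sym i j) (Graph.sym H i j)

N-diagonal : ∀ {n} (H : Graph n) i → N H i i ≡ true
N-diagonal H i = cong (_∨ adj H i i) (⌊≟⌋-refl i)

module Toggle {n} (G : Graph n) (A₁ A₂ : Vec₂ n) (G* : Graph n)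
  (G*-toggles : ∀ u v → adj G* u v ≡ toggle-adj G A₁ A₂ u v) (disjoint : Disjoint A₁ A₂) where

  N-toggle : ∀ i j → N G* i j ≡ (N G i ⊕ A₁ i ⋆ A₂ ⊕ A₂ i ⋆ A₁) j
  N-toggle i j with i ≟ j
  ... | yes refl = cong (true xor_) (sym (trans (cong (_xor A₂ i ∧ A₁ i) (∧-comm (A₁ i) (A₂ i)))
                                                (xor-same (A₂ i ∧ A₁ i))))
  ... | no _ = trans (G*-toggles i j)
                     (cong (adj G i j xor_) (∨≡xor {A₁ i ∧ A₂ j} {A₂ i ∧ A₁ j} exclusive))
    where
    exclusive : (A₁ i ∧ A₂ j) ∧ (A₂ i ∧ A₁ j) ≡ false
    exclusive = trans (∧.interchange (A₁ i) (A₂ j) (A₂ i) (A₁ j))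
                      (cong (_∧ A₂ j ∧ A₁ j) (disjoint i))

  correction : Vec₂ n → Vec₂ n
  correction p = A₂ · p ⋆ A₁ ⊕ A₁ · p ⋆ A₂

  ⊛-toggle : ∀ p → (N G* ⊛ p) ≐ (N G ⊛ p ⊕ correction p)
  ⊛-toggle p i = begin
    (N G* ⊛ p) i                                         ≡⟨ ·-congˡ (N-toggle i) p ⟩
    (N G i ⊕ A₁ i ⋆ A₂ ⊕ A₂ i ⋆ A₁) · p                 ≡⟨ ·-⊕ˡ (N G i) _ p ⟩
    (N G ⊛ p) i xor (A₁ i ⋆ A₂ ⊕ A₂ i ⋆ A₁) · p         ≡⟨ cong ((N G ⊛ p) i xor_) rank-two ⟩
    (N G ⊛ p) i xor correction p i                       ∎
    where
    rank-two : (A₁ i ⋆ A₂ ⊕ A₂ i ⋆ A₁) · p ≡ correction p i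
    rank-two = trans (·-⊕ˡ (A₁ i ⋆ A₂) (A₂ i ⋆ A₁) p)
                     (cong₂ _xor_ (trans (·-⋆ˡ (A₁ i) A₂ p) (∧-comm (A₁ i) (A₂ · p)))
                                  (trans (·-⋆ˡ (A₂ i) A₁ p) (∧-comm (A₂ i) (A₁ · p))))

  correction-· : ∀ p u → correction p · u ≡ A₂ · p ∧ A₁ · u xor A₁ · p ∧ A₂ · u
  correction-· p u = trans (·-⊕ˡ (A₂ · p ⋆ A₁) (A₁ · p ⋆ A₂) u)
                           (cong₂ _xor_ (·-⋆ˡ (A₂ · p) A₁ u) (·-⋆ˡ (A₁ · p) A₂ u))

  ⊛-toggle-unchanged : ∀ {p} → A₁ · p ≡ false → A₂ · p ≡ false → (N G* ⊛ p) ≐ (N G ⊛ p)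
  ⊛-toggle-unchanged {p} A₁·p A₂·p i = begin
    (N G* ⊛ p) i
      ≡⟨ ⊛-toggle p i ⟩
    (N G ⊛ p) i xor (A₂ · p ∧ A₁ i xor A₁ · p ∧ A₂ i)
      ≡⟨ cong₂ (λ β α → (N G ⊛ p) i xor (β ∧ A₁ i xor α ∧ A₂ i)) A₂·p A₁·p ⟩
    (N G ⊛ p) i xor false
      ≡⟨ xor-identityʳ _ ⟩
    (N G ⊛ p) i ∎

  module _ (dp : DualPair (N G) A₁ A₂) where
    open DualPair dp

    correction-·u₁ : ∀ p → correction p · u₁ ≡ A₂ · p
    correction-·u₁ p = begin
      correction p · u₁
        ≡⟨ correction-· p u₁ ⟩
      A₂ · p ∧ A₁ · u₁ xor A₁ · p ∧ A₂ · u₁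
        ≡⟨ cong₂ (λ a b → A₂ · p ∧ a xor A₁ · p ∧ b) A₁·u₁≡true A₂·u₁≡false ⟩
      A₂ · p ∧ true xor A₁ · p ∧ false
        ≡⟨ cong₂ _xor_ (∧-identityʳ (A₂ · p)) (∧-zeroʳ (A₁ · p)) ⟩
      A₂ · p xor false
        ≡⟨ xor-identityʳ _ ⟩
      A₂ · p ∎

    correction-·u₂ : ∀ p → correction p · u₂ ≡ A₁ · p
    correction-·u₂ p = begin
      correction p · u₂
        ≡⟨ correction-· p u₂ ⟩
      A₂ · p ∧ A₁ · u₂ xor A₁ · p ∧ A₂ · u₂
        ≡⟨ cong₂ (λ a b → A₂ · p ∧ a xor A₁ · p ∧ b) A₁·u₂≡false A₂·u₂≡true ⟩
      A₂ · p ∧ false xor A₁ · p ∧ true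
        ≡⟨ cong₂ _xor_ (∧-zeroʳ (A₂ · p)) (∧-identityʳ (A₁ · p)) ⟩
      A₁ · p ∎

    ⊛-toggle-preimage : ∀ {p w} → (∀ k → Ker (N G) k → w · k ≡ false) → (N G* ⊛ p) ≐ w →
                        (A₁ · p ≡ false) × (A₂ · p ≡ false)
    ⊛-toggle-preimage {p} {w} w⊥ker N*p≐w =
      trans (sym (correction-·u₂ p)) (correction⊥ker u₂∈ker) ,
      trans (sym (correction-·u₁ p)) (correction⊥ker u₁∈ker)
      where
      correction⊥ker : ∀ {u} → Ker (N G) u → correction p · u ≡ false
      correction⊥ker {u} u∈ker = begin
        correction p · u
          ≡⟨ cong (_xor correction p · u) (sym (range⊥ker (N-symmetric G) u∈ker p)) ⟩
        (N G ⊛ p) · u xor correction p · u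
          ≡⟨ sym (·-⊕ˡ _ _ u) ⟩
        (N G ⊛ p ⊕ correction p) · u
          ≡⟨ sym (·-congˡ (⊛-toggle p) u) ⟩
        (N G* ⊛ p) · u
          ≡⟨ ·-congˡ N*p≐w u ⟩
        w · u
          ≡⟨ w⊥ker u u∈ker ⟩
        false ∎

    ⊛-toggle≐⇔ : ∀ {w} → (∀ k → Ker (N G) k → w · k ≡ false) → ∀ p →
                 ((N G* ⊛ p) ≐ w) ⇔ (((N G ⊛ p) ≐ w) × (A₁ · p ≡ false) × (A₂ · p ≡ false))
    ⊛-toggle≐⇔ {w} w⊥ker p = mk⇔ to from
      where
      to : (N G* ⊛ p) ≐ w → ((N G ⊛ p) ≐ w) × (A₁ · p ≡ false) × (A₂ · p ≡ false)
      to N*p≐w = let A₁·p , A₂·p = ⊛-toggle-preimage w⊥ker N*p≐w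
                 in (λ i → trans (sym (⊛-toggle-unchanged A₁·p A₂·p i)) (N*p≐w i)) , A₁·p , A₂·p
      from : ((N G ⊛ p) ≐ w) × (A₁ · p ≡ false) × (A₂ · p ≡ false) → (N G* ⊛ p) ≐ w
      from (Np≐w , A₁·p , A₂·p) i = trans (⊛-toggle-unchanged A₁·p A₂·p i) (Np≐w i)

    ⊛-toggle≐𝟏⇔ : ∀ p →
      ((N G* ⊛ p) ≐ 𝟏) ⇔ (((N G ⊛ p) ≐ 𝟏) × (A₁ · p ≡ false) × (A₂ · p ≡ false))
    ⊛-toggle≐𝟏⇔ = ⊛-toggle≐⇔ (λ k → 𝟏⊥ker (N-symmetric G) (N-diagonal G))

    Ker-toggle⇔ : ∀ k → Ker (N G*) k ⇔ (Ker (N G) k × (A₁ · k ≡ false) × (A₂ · k ≡ false))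
    Ker-toggle⇔ = ⊛-toggle≐⇔ (λ k _ → sum₂-zero {n} {λ _ → false} (λ _ → refl))

    ⊛-toggle-u₂ : (N G* ⊛ u₂) ≐ A₁
    ⊛-toggle-u₂ i = begin
      (N G* ⊛ u₂) i
        ≡⟨ ⊛-toggle u₂ i ⟩
      (N G ⊛ u₂) i xor (A₂ · u₂ ∧ A₁ i xor A₁ · u₂ ∧ A₂ i)
        ≡⟨ cong₂ (λ x β → x xor (β ∧ A₁ i xor A₁ · u₂ ∧ A₂ i)) (u₂∈ker i) A₂·u₂≡true ⟩
      true ∧ A₁ i xor A₁ · u₂ ∧ A₂ i
        ≡⟨ cong (λ α → A₁ i xor α ∧ A₂ i) A₁·u₂≡false ⟩
      A₁ i xor false
        ≡⟨ xor-identityʳ _ ⟩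
      A₁ i ∎

    ⊛-toggle-u₁ : (N G* ⊛ u₁) ≐ A₂
    ⊛-toggle-u₁ i = begin
      (N G* ⊛ u₁) i
        ≡⟨ ⊛-toggle u₁ i ⟩
      (N G ⊛ u₁) i xor (A₂ · u₁ ∧ A₁ i xor A₁ · u₁ ∧ A₂ i)
        ≡⟨ cong₂ (λ x β → x xor (β ∧ A₁ i xor A₁ · u₁ ∧ A₂ i)) (u₁∈ker i) A₂·u₁≡false ⟩
      A₁ · u₁ ∧ A₂ i
        ≡⟨ cong (_∧ A₂ i) A₁·u₁≡true ⟩
      A₂ i ∎

    A₁-NO : NO (N G*) A₁
    A₁-NO = (u₂ , ⊛-toggle-u₂) ,
            λ p N*p≐𝟏 → proj₁ (proj₂ (Equivalence.to (⊛-toggle≐𝟏⇔ p) N*p≐𝟏))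

    A₂-NO : NO (N G*) A₂
    A₂-NO = (u₁ , ⊛-toggle-u₁) ,
            λ p N*p≐𝟏 → proj₂ (proj₂ (Equivalence.to (⊛-toggle≐𝟏⇔ p) N*p≐𝟏))

    module _ {ν ν*} (B : KerBasis (N G) ν) (B* : KerBasis (N G*) ν*) where
      open KerBasis

      extended : Fin (2 + ν*) → Vec₂ n
      extended = u₁ ∷ u₂ ∷ vec B*

      extended∈ker : ∀ l → Ker (N G) (extended l)
      extended∈ker zero          = u₁∈ker
      extended∈ker (suc zero)    = u₂∈ker
      extended∈ker (suc (suc i)) = proj₁ (Equivalence.to (Ker-toggle⇔ _) (inKer B* i))

      A₁·extended : ∀ l → A₁ · extended l ≡ unit zero l
      A₁·extended zero          = A₁·u₁≡true
      A₁·extended (suc zero)    = A₁·u₂≡false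
      A₁·extended (suc (suc i)) = proj₁ (proj₂ (Equivalence.to (Ker-toggle⇔ _) (inKer B* i)))

      A₂·extended : ∀ l → A₂ · extended l ≡ unit (suc zero) l
      A₂·extended zero          = A₂·u₁≡false
      A₂·extended (suc zero)    = A₂·u₂≡true
      A₂·extended (suc (suc i)) = proj₂ (proj₂ (Equivalence.to (Ker-toggle⇔ _) (inKer B* i)))

      A₁·lincomb-extended : ∀ c → A₁ · lincomb extended c ≡ c zero
      A₁·lincomb-extended c =
        trans (·-lincomb A₁ extended c) (trans (·-congʳ c A₁·extended) (·-unitʳ c zero))

      A₂·lincomb-extended : ∀ c → A₂ · lincomb extended c ≡ c (suc zero)
      A₂·lincomb-extended c =
        trans (·-lincomb A₂ extended c) (trans (·-congʳ c A₂·extended) (·-unitʳ c (suc zero)))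

      extended-independent : Independent extended
      extended-independent c c≐𝟎 = λ { zero → c₀ ; (suc zero) → c₁ ; (suc (suc i)) → rest i }
        where
        c₀ : c zero ≡ false
        c₀ = trans (sym (A₁·lincomb-extended c)) (trans (·-congʳ A₁ c≐𝟎) (·-zeroʳ A₁))
        c₁ : c (suc zero) ≡ false
        c₁ = trans (sym (A₂·lincomb-extended c)) (trans (·-congʳ A₂ c≐𝟎) (·-zeroʳ A₂))
        rest : (λ i → c (suc (suc i))) ≐ 𝟎
        rest = indep B* (λ i → c (suc (suc i))) λ j →
          trans (sym (cong₂ (λ a b → a ∧ u₁ j xor b ∧ u₂ j xor lincomb (vec B*) (λ i → c (suc (suc i))) j)
                            c₀ c₁))
                (c≐𝟎 j)

      extended-spans : ∀ c → Σ (Fin (2 + ν*) → Bool) λ c' → lincomb extended c' ≐ lincomb (vec B) c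
      extended-spans c = coordinates , λ j → begin
        lincomb extended coordinates j         ≡⟨ ·-congˡ split (λ l → extended l j) ⟩
        lincomb extended (along ⊕ off) j       ≡⟨ ·-⊕ˡ along off (λ l → extended l j) ⟩
        s j xor lincomb (vec B*) c* j          ≡⟨ cong (s j xor_) (c*≐q j) ⟩
        s j xor (s j xor p j)                  ≡⟨ xor-cancelˡ (s j) (p j) ⟩
        p j                                    ∎
        where
        p : Vec₂ n
        p = lincomb (vec B) c
        along : Fin (2 + ν*) → Bool
        along = A₁ · p ∷ A₂ · p ∷ 𝟎
        s q : Vec₂ n
        s = lincomb extended along
        q = s ⊕ p
        q∈ker* : Ker (N G*) q
        q∈ker* = Equivalence.from (Ker-toggle⇔ q)
          ( Ker-⊕ {M = N G} (Ker-lincomb extended∈ker along) (Ker-lincomb {b = vec B} (inKer B) c)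
          , trans (·-⊕ʳ A₁ s p)
                  (trans (cong (_xor A₁ · p) (A₁·lincomb-extended along)) (xor-same (A₁ · p)))
          , trans (·-⊕ʳ A₂ s p)
                  (trans (cong (_xor A₂ · p) (A₂·lincomb-extended along)) (xor-same (A₂ · p))))
        c* : Fin ν* → Bool
        c* = proj₁ (spanning B* q q∈ker*)
        c*≐q : lincomb (vec B*) c* ≐ q
        c*≐q = proj₂ (spanning B* q q∈ker*)
        off coordinates : Fin (2 + ν*) → Bool
        off = false ∷ false ∷ c*
        coordinates = A₁ · p ∷ A₂ · p ∷ c*
        split : coordinates ≐ (along ⊕ off)
        split zero          = sym (xor-identityʳ _)
        split (suc zero)    = sym (xor-identityʳ _)
        split (suc (suc i)) = refl

      dimKer-toggle : ν ≡ ν* + 2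
      dimKer-toggle = trans (≤-antisym (independent≤spanning (vec B) extended (indep B) extended-spans)
                                       (independent≤spanning extended (vec B) extended-independent
                                          (λ c → spanning B _ (Ker-lincomb extended∈ker c))))
                            (+-comm 2 ν*)

mainTheorem17 : ∀ {n} (G : Graph n) (A₁ A₂ : Vec₂ n)
    (G* : Graph n) → (∀ u v → adj G* u v ≡ toggle-adj G A₁ A₂ u v) →
    Disjoint A₁ A₂ →
    HO (N G) A₁ → HO (N G) A₂ → HO (N G) (A₁ ∪ A₂) →
    ((p : Vec₂ n) →
      ((N G* ⊛ p) ≐ 𝟏) ⇔ (((N G ⊛ p) ≐ 𝟏) × (A₁ · p ≡ false) × (A₂ · p ≡ false)))
    × NO (N G*) A₁ × NO (N G*) A₂
    × (∀ ν ν* → DimKer (N G) ν → DimKer (N G*) ν* → ν ≡ ν* + 2)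
mainTheorem17 G A₁ A₂ G* G*-toggles disjoint A₁-HO A₂-HO A₁∪A₂-HO =
  ⊛-toggle≐𝟏⇔ dp , A₁-NO dp , A₂-NO dp , λ _ _ → dimKer-toggle dp
  where
  open Toggle G A₁ A₂ G* G*-toggles disjoint
  dp : DualPair (N G) A₁ A₂
  dp = dualPair (N-symmetric G) disjoint A₁-HO A₂-HO A₁∪A₂-HO
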